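{- Let $R(\mathbf{x},\mathbf{x}')$ be a difference bounds constraint over $N$ variables, let $n\ge1$ and $0\le p\le q\le n$ be integers, let $\rho$ be a path in $\mathcal{G}_R^n$ between extremal vertices, and let $\xi\in\mathrm{segments}(\rho,p,q)$ have at least one subpath that is an lb-corner. Then the first lb-corner of $\xi$ is a right corner if and only if $\xi$ starts at position $p$, and it is a left corner if and only if $\xi$ starts at position $q$.
   Context: Variables range over $\mathbb{Z}$; $\mathbf{x}=\{x_1,\dots,x_N\}$. A difference bounds constraint is a finite conjunction of atoms $u-v\le c$, $c\in\mathbb{Z}$; its constraint graph has an edge $u\xrightarrow{c}v$ per atom. With fresh copies $x_i^{(p)}$ (position $p$), $\mathcal{G}_R^n$ is the union over $p=0,\dots,n-1$ of the constraint graphs of $R(\mathbf{x}^{(p)},\mathbf{x}^{(p+1)})$; extremal vertices are those at positions $0$ and $n$. A corner is a path $x_{i_0}^{(k_0)}\to\cdots\to x_{i_m}^{(k_m)}$, $m\ge1$, with $k_0=k_m$; it is a right corner of extent $d$ if its positions are $\{k_0,\dots,k_0+d\}$, a left corner of extent $d$ if they are $\{k_0-d,\dots,k_0\}$; basic if $k_0\notin\{k_1,\dots,k_{m-1}\}$; long if $d>N^2$; an lb-corner if long and basic. For $0\le p\le q\le n$, $\mathrm{segments}(\rho,p,q)$ is the sequence of maximal subpaths of $\rho$ consisting of consecutive edges of $\rho$ both of whose endpoints have positions in $\{p,\dots,q\}$. The first lb-corner of a path $\xi$ having an lb-corner subpath is the unique lb-corner subpath $\theta$ such that $\xi=\xi_1.\theta.\xi_2$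 and $\theta$ is the only lb-corner subpath of $\xi_1.\theta$ (equivalently, the lb-corner subpath whose last vertex occurs earliest in $\xi$). -}

module Defs where

open import Data.Nat using (ℕ; zero; suc; _+_; _*_; _∸_; _≤_; _<_)
open import Data.Fin using (Fin; toℕ)
open import Data.Integer using (ℤ)
open import Data.List using (List)
open import Data.List.Membership.Propositional using (_∈_)
open import Data.Product using (Σ; ∃; ∃-syntax; _×_; _,_; proj₁; proj₂)
open import Data.Sum using (_⊎_)
open import Relation.Binary.PropositionalEquality using (_≡_; _≢_)

-- A variable of R(x, x') over N variables: (i , 0) is x_i, (i , 1) is x'_i.
Var : ℕ → Set
Var N = Fin N × Fin 2

-- An atom  u - v ≤ c.
record Atom (N : ℕ) : Set where
  constructor atom
  field
    u : Var N
    v : Var N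
    c : ℤ

DBC : ℕ → Set
DBC N = List (Atom N)

-- Vertices of G_R^n: x_i^(p) is represented by (i , p).
Vertex : ℕ → Set
Vertex N = Fin N × ℕ

pos : ∀ {N} → Vertex N → ℕ
pos = proj₂

-- Edges of G_R^n: for every atom u - v ≤ c of R and every p < n, an edge
-- u^(p + off u) → v^(p + off v) (off = 0 for x, 1 for x').
Edge : ∀ {N} → DBC N → ℕ → Vertex N → Vertex N → Set
Edge {N} R n w w' =
  Σ (Atom N) λ a → a ∈ R × Σ ℕ λ p → p < n ×
    (w  ≡ (proj₁ (Atom.u a) , p + toℕ (proj₂ (Atom.u a)))) ×
    (w' ≡ (proj₁ (Atom.v a) , p + toℕ (proj₂ (Atom.v a))))

-- A path in G_R^n with m edges: vertices vtx 0 , … , vtx m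
-- (values of vtx beyond m are irrelevant).
record Path {N : ℕ} (R : DBC N) (n : ℕ) : Set where
  field
    len   : ℕ
    vtx   : ℕ → Vertex N
    edges : ∀ i → i < len → Edge R n (vtx i) (vtx (suc i))
open Path public

posAt : ∀ {N} {R : DBC N} {n} → Path R n → ℕ → ℕ
posAt ρ i = pos (vtx ρ i)

Extremal : ℕ → ℕ → Set
Extremal n k = (k ≡ 0) ⊎ (k ≡ n)

BetweenExtremal : ∀ {N} {R : DBC N} {n} → Path R n → Set
BetweenExtremal {n = n} ρ = Extremal n (posAt ρ 0) × Extremal n (posAt ρ (len ρ))

InRange : ℕ → ℕ → ℕ → Set
InRange p q k = p ≤ k × k ≤ q

-- The subpath of ρ from vertex index a to vertex index b (a < b ≤ len ρ)
-- is an element of segments(ρ,p,q): all its vertices have positions in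
-- {p,…,q} (hence all its edges have both endpoints there), and it is maximal.
IsSegment : ∀ {N} {R : DBC N} {n} → Path R n → ℕ → ℕ → ℕ → ℕ → Set
IsSegment ρ p q a b =
  a < b × b ≤ len ρ ×
  (∀ i → a ≤ i → i ≤ b → InRange p q (posAt ρ i)) ×
  (∀ a' → suc a' ≡ a → InRange p q (posAt ρ a') → Data.Empty.⊥) ×
  (b < len ρ → InRange p q (posAt ρ (suc b)) → Data.Empty.⊥)
  where import Data.Empty

IsCorner : ∀ {N} {R : DBC N} {n} → Path R n → ℕ → ℕ → Set
IsCorner ρ s t = s < t × posAt ρ s ≡ posAt ρ t

IsRightCorner : ∀ {N} {R : DBC N} {n} → Path R n → ℕ → ℕ → ℕ → Set
IsRightCorner ρ s t d =
  IsCorner ρ s t ×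
  (∀ i → s ≤ i → i ≤ t → InRange (posAt ρ s) (posAt ρ s + d) (posAt ρ i)) ×
  (∀ k → InRange (posAt ρ s) (posAt ρ s + d) k → ∃[ i ] (s ≤ i × i ≤ t × posAt ρ i ≡ k))

IsLeftCorner : ∀ {N} {R : DBC N} {n} → Path R n → ℕ → ℕ → ℕ → Set
IsLeftCorner ρ s t d =
  IsCorner ρ s t × d ≤ posAt ρ s ×
  (∀ i → s ≤ i → i ≤ t → InRange (posAt ρ s ∸ d) (posAt ρ s) (posAt ρ i)) ×
  (∀ k → InRange (posAt ρ s ∸ d) (posAt ρ s) k → ∃[ i ] (s ≤ i × i ≤ t × posAt ρ i ≡ k))

IsBasic : ∀ {N} {R : DBC N} {n} → Path R n → ℕ → ℕ → Set
IsBasic ρ s t = IsCorner ρ s t × (∀ i → s < i → i < t → posAt ρ i ≢ posAt ρ s)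

IsLong : ∀ {N} {R : DBC N} {n} → Path R n → ℕ → ℕ → Set
IsLong {N} ρ s t = ∃[ d ] (N * N < d × (IsRightCorner ρ s t d ⊎ IsLeftCorner ρ s t d))

IsLB : ∀ {N} {R : DBC N} {n} → Path R n → ℕ → ℕ → Set
IsLB ρ s t = IsLong ρ s t × IsBasic ρ s t

IsLBIn : ∀ {N} {R : DBC N} {n} → Path R n → ℕ → ℕ → ℕ → ℕ → Set
IsLBIn ρ a b s t = a ≤ s × t ≤ b × IsLB ρ s t

IsFirstLB : ∀ {N} {R : DBC N} {n} → Path R n → ℕ → ℕ → ℕ → ℕ → Set
IsFirstLB ρ a b s t =
  IsLBIn ρ a b s t ×
  (∀ s' t' → IsLBIn ρ a b s' t' → t' ≤ t → (s' ≡ s × t' ≡ t))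

module Submission where

-- The only property of G_R^n the argument uses is that positions change by
-- at most one along an edge.  A segment starts at p or q
--    because the vertex before it lies outside {p,…,q}.

open import Defs
open import Data.Nat using (ℕ; zero; suc; _+_; _*_; _∸_; _≤_; _<_; _≥_; z≤n; s≤s; s≤s⁻¹;
  _≤?_; _<?_; _≟_)
open import Data.Nat.Properties
open import Data.Nat.Induction using (<-rec)
open import Data.Fin using (Fin; toℕ)
open import Data.Fin.Properties using (toℕ≤pred[n])
open import Data.Product using (∃; ∃-syntax; _×_; _,_; proj₁; proj₂)
open import Data.Sum using (_⊎_; inj₁; inj₂)
open import Data.Empty using (⊥; ⊥-elim)
open import Function using (_∘_)
open import Function.Bundles using (_⇔_; mk⇔)
open import Level using (0ℓ)
open import Relation.Binary.Core using (Rel)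
open import Relation.Binary.Definitions using (Total; Transitive; tri<; tri≈; tri>)
open import Relation.Nullary using (¬_; Dec; yes; no)
open import Relation.Nullary.Decidable using (map′; decidable-stable; _×-dec_; _→-dec_; _⊎-dec_; ¬?)
open import Relation.Unary using (Decidable)
open import Relation.Binary.PropositionalEquality using (_≡_; _≢_; refl; sym; trans; cong; subst)

splitLast : ∀ {y t} → y ≤ suc t → y ≤ t ⊎ y ≡ suc t
splitLast y≤st with m≤n⇒m<n∨m≡n y≤st
... | inj₁ y<st = inj₁ (s≤s⁻¹ y<st)
... | inj₂ y≡st = inj₂ y≡st

leastWitness : {Q : ℕ → Set} → Decidable Q → ∀ {t} → Q t →
  ∃[ u ] (u ≤ t × Q u × (∀ v → v < u → ¬ Q v))
leastWitness {Q} Q? {t} = <-rec Goal search t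
  where
  Goal : ℕ → Set
  Goal t = Q t → ∃[ u ] (u ≤ t × Q u × (∀ v → v < u → ¬ Q v))
  search : ∀ t → (∀ {v} → v < t → Goal v) → Goal t
  search t smaller Qt with anyUpTo? Q? t
  ... | no none = t , ≤-refl , Qt , λ v v<t Qv → none (v , v<t , Qv)
  ... | yes (v , v<t , Qv) with smaller v<t Qv
  ...   | (u , u≤v , Qu , minimal) = u , ≤-trans u≤v (<⇒≤ v<t) , Qu , minimal

module Switch {A : ℕ → Set} (A? : Decidable A) where

  lastEntry : ∀ {i} j → i ≤ j → ¬ A i → A j →
    ∃[ x ] (i ≤ x × x < j × ¬ A x × (∀ y → x < y → y ≤ j → A y))
  lastEntry zero z≤n ¬Ai Aj = ⊥-elim (¬Ai Aj)
  lastEntry (suc j) i≤sj ¬Ai Asj with splitLast i≤sj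
  ... | inj₂ refl = ⊥-elim (¬Ai Asj)
  ... | inj₁ i≤j with A? j
  ...   | no ¬Aj = j , i≤j , n<1+n j , ¬Aj , onlyLast
    where
    onlyLast : ∀ y → j < y → y ≤ suc j → A y
    onlyLast y j<y y≤sj = subst A (sym (≤-antisym y≤sj j<y)) Asj
  ...   | yes Aj with lastEntry j i≤j ¬Ai Aj
  ...     | (x , i≤x , x<j , ¬Ax , inA) = x , i≤x , m<n⇒m<1+n x<j , ¬Ax , inA′
    where
    inA′ : ∀ y → x < y → y ≤ suc j → A y
    inA′ y x<y y≤sj with splitLast y≤sj
    ... | inj₁ y≤j = inA y x<y y≤j
    ... | inj₂ refl = Asj

  firstExit : ∀ {i j} → i ≤ j → A i → ¬ A j →
    ∃[ x ] (i < x × x ≤ j × ¬ A x × (∀ y → i ≤ y → y < x → A y))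
  firstExit {i} i≤j Ai ¬Aj
    with leastWitness (λ y → (i ≤? y) ×-dec ¬? (A? y)) (i≤j , ¬Aj)
  ... | (x , x≤j , (i≤x , ¬Ax) , earlier) =
    x , ≤∧≢⇒< i≤x (λ { refl → ¬Ax Ai }) , x≤j , ¬Ax ,
    λ y i≤y y<x → decidable-stable (A? y) (λ ¬Ay → earlier y y<x (i≤y , ¬Ay))

totalRefl : {_⊑_ : Rel ℕ 0ℓ} → Total _⊑_ → ∀ u → u ⊑ u
totalRefl total u with total u u
... | inj₁ u⊑u = u⊑u
... | inj₂ u⊑u = u⊑u

extremum : {_⊑_ : Rel ℕ 0ℓ} → Total _⊑_ → Transitive _⊑_ → (f : ℕ → ℕ) →
  ∀ {s} t → s ≤ t → ∃[ x ] (s ≤ x × x ≤ t × (∀ y → s ≤ y → y ≤ t → f y ⊑ f x))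
extremum {_⊑_} total ⊑-trans f {s} t s≤t with m≤n⇒m<n∨m≡n s≤t
... | inj₂ refl = s , ≤-refl , ≤-refl , λ y s≤y y≤s →
  subst (λ z → f z ⊑ f s) (sym (≤-antisym y≤s s≤y)) (totalRefl total (f s))
extremum total ⊑-trans f zero _ | inj₁ ()
extremum {_⊑_} total ⊑-trans f {s} (suc t) _ | inj₁ s<st
  with extremum total ⊑-trans f t (s≤s⁻¹ s<st)
... | (x , s≤x , x≤t , best) with total (f x) (f (suc t))
...   | inj₁ fx⊑ = suc t , <⇒≤ s<st , ≤-refl , bestUpTo
  where
  bestUpTo : ∀ y → s ≤ y → y ≤ suc t → f y ⊑ f (suc t)
  bestUpTo y s≤y y≤st with splitLast y≤st
  ... | inj₁ y≤t = ⊑-trans (best y s≤y y≤t) fx⊑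
  ... | inj₂ refl = totalRefl total (f y)
...   | inj₂ ⊑fx = x , s≤x , m≤n⇒m≤1+n x≤t , bestUpTo
  where
  bestUpTo : ∀ y → s ≤ y → y ≤ suc t → f y ⊑ f x
  bestUpTo y s≤y y≤st with splitLast y≤st
  ... | inj₁ y≤t = best y s≤y y≤t
  ... | inj₂ refl = ⊑fx

UnitSteps : (ℕ → ℕ) → ℕ → Set
UnitSteps f L = ∀ i → i < L → f (suc i) ≤ suc (f i) × f i ≤ suc (f (suc i))

-- A side of the level k: a decidable set of points avoiding k which, since f
-- has unit steps, can only be entered from k and only be left to k.
record Side (f : ℕ → ℕ) (L k : ℕ) : Set₁ where
  field
    In     : ℕ → Set
    In?    : Decidable In
    avoids : ∀ {y} → In y → f y ≢ k
    enter  : ∀ {x} → x < L → ¬ In x → In (suc x) → f x ≡ k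
    leave  : ∀ {x} → x < L → In x → ¬ In (suc x) → f (suc x) ≡ k

above : ∀ {f L} → UnitSteps f L → ∀ k → Side f L k
above {f} steps k = record
  { In     = λ y → k < f y
  ; In?    = λ y → k <? f y
  ; avoids = >⇒≢
  ; enter  = λ {x} x<L notHere inNext →
      ≤-antisym (≮⇒≥ notHere) (s≤s⁻¹ (≤-trans inNext (proj₁ (steps x x<L))))
  ; leave  = λ {x} x<L inHere notNext →
      ≤-antisym (≮⇒≥ notNext) (s≤s⁻¹ (≤-trans inHere (proj₂ (steps x x<L))))
  }

below : ∀ {f L} → UnitSteps f L → ∀ k → Side f L k
below {f} steps k = record
  { In     = λ y → f y < k
  ; In?    = λ y → f y <? k
  ; avoids = <⇒≢
  ; enter  = λ {x} x<L notHere inNext →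
      ≤-antisym (≤-trans (proj₂ (steps x x<L)) inNext) (≮⇒≥ notHere)
  ; leave  = λ {x} x<L inHere notNext →
      ≤-antisym (≤-trans (proj₁ (steps x x<L)) inHere) (≮⇒≥ notNext)
  }

module Crossing {f : ℕ → ℕ} {L k : ℕ} (S : Side f L k) where
  open Side S
  open Switch In?

  lastEntryPoint : ∀ {i j} → i ≤ j → j ≤ L → ¬ In i → In j →
    ∃[ x ] (i ≤ x × x < j × f x ≡ k × (∀ y → x < y → y ≤ j → In y))
  lastEntryPoint {j = j} i≤j j≤L ¬Ai Aj with lastEntry j i≤j ¬Ai Aj
  ... | (x , i≤x , x<j , ¬Ax , after) =
    x , i≤x , x<j , enter (<-≤-trans x<j j≤L) ¬Ax (after (suc x) (n<1+n x) x<j) , after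

  firstExitPoint : ∀ {i j} → i ≤ j → j ≤ L → In i → ¬ In j →
    ∃[ x ] (i < x × x ≤ j × f x ≡ k × (∀ y → i ≤ y → y < x → In y))
  firstExitPoint i≤j j≤L Ai ¬Aj with firstExit i≤j Ai ¬Aj
  ... | (zero , () , _)
  ... | (suc x , i<sx , sx≤j , ¬Asx , before) =
    suc x , i<sx , sx≤j , leave (≤-trans sx≤j j≤L) (before x (s≤s⁻¹ i<sx) (n<1+n x)) ¬Asx , before

  innerHit : ∀ {i j} → i ≤ j → j ≤ L → ¬ In i → f i ≢ k → In j →
    ∃[ x ] (i < x × x < j × f x ≡ k)
  innerHit i≤j j≤L ¬Ai fi≢k Aj with lastEntryPoint i≤j j≤L ¬Ai Aj
  ... | (x , i≤x , x<j , fx≡k , _) =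
    x , ≤∧≢⇒< i≤x (λ i≡x → fi≢k (trans (cong f i≡x) fx≡k)) , x<j , fx≡k

reach : ∀ {f L i j k} → UnitSteps f L → i ≤ j → j ≤ L →
  (f i ≤ k × k ≤ f j) ⊎ (f j ≤ k × k ≤ f i) → ∃[ x ] (i ≤ x × x ≤ j × f x ≡ k)
reach {f} {L} {i} {j} {k} steps i≤j j≤L between with f j ≟ k
... | yes fj≡k = j , i≤j , ≤-refl , fj≡k
... | no fj≢k = hit between
  where
  throughSide : (S : Side f L k) → ¬ Side.In S i → Side.In S j → ∃[ x ] (i ≤ x × x ≤ j × f x ≡ k)
  throughSide S ¬Ai Aj with Crossing.lastEntryPoint S i≤j j≤L ¬Ai Aj
  ... | (x , i≤x , x<j , fx≡k , _) = x , i≤x , <⇒≤ x<j , fx≡k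
  hit : (f i ≤ k × k ≤ f j) ⊎ (f j ≤ k × k ≤ f i) → ∃[ x ] (i ≤ x × x ≤ j × f x ≡ k)
  hit (inj₁ (fi≤k , k≤fj)) = throughSide (above steps k) (≤⇒≯ fi≤k) (≤∧≢⇒< k≤fj (fj≢k ∘ sym))
  hit (inj₂ (fj≤k , k≤fi)) = throughSide (below steps k) (≤⇒≯ k≤fi) (≤∧≢⇒< fj≤k fj≢k)

-- An edge changes the position by at most one: offsets are 0 or 1.
unitOffset : ∀ p (x y : Fin 2) → p + toℕ y ≤ suc (p + toℕ x)
unitOffset p x y =
  ≤-trans (+-monoʳ-≤ p (≤-trans (toℕ≤pred[n] y) (s≤s z≤n))) (≤-reflexive (+-suc p (toℕ x)))

pathUnitSteps : ∀ {N} {R : DBC N} {n} (ρ : Path R n) → UnitSteps (posAt ρ) (len ρ)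
pathUnitSteps ρ i i<len with edges ρ i i<len
... | (atom u v _ , _ , p , _ , at-i , at-si) rewrite at-i | at-si =
  unitOffset p (proj₂ u) (proj₂ v) , unitOffset p (proj₂ v) (proj₂ u)

Far : ℕ → ℕ → ℕ → Set
Far D u v = u + D < v ⊎ v + D < u

far? : ∀ D u v → Dec (Far D u v)
far? D u v = (u + D <? v) ⊎-dec (v + D <? u)

-- The bottom of a left corner of extent d > D is far below its base.
troughFar : ∀ {D u d} → d ≤ u → D < d → (u ∸ d) + D < u
troughFar {D} {u} {d} d≤u D<d =
  <-≤-trans (+-monoʳ-< (u ∸ d) D<d) (≤-reflexive (m∸n+n≡m d≤u))

module Corners {N : ℕ} {R : DBC N} {n : ℕ} (ρ : Path R n) where

  P : ℕ → ℕ
  P = posAt ρ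

  L : ℕ
  L = len ρ

  steps : UnitSteps P L
  steps = pathUnitSteps ρ

  rightPeak : ∀ {s t d} → IsRightCorner ρ s t d → ∃[ m ] (s ≤ m × m ≤ t × P m ≡ P s + d)
  rightPeak {s} {d = d} (_ , _ , onto) = onto (P s + d) (m≤m+n (P s) d , ≤-refl)

  leftTrough : ∀ {s t d} → IsLeftCorner ρ s t d → ∃[ m ] (s ≤ m × m ≤ t × P m ≡ P s ∸ d)
  leftTrough {s} {d = d} (_ , _ , _ , onto) = onto (P s ∸ d) (≤-refl , m∸n≤m (P s) d)

  rightNotLeft : ∀ {s t d d′} → IsRightCorner ρ s t d → 0 < d → ¬ IsLeftCorner ρ s t d′
  rightNotLeft {s} rc 0<d (_ , _ , range , _) with rightPeak rc
  ... | (m , s≤m , m≤t , Pm≡) =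
    <⇒≱ (m<m+n (P s) 0<d) (subst (_≤ P s) Pm≡ (proj₂ (range m s≤m m≤t)))

  leftNotRight : ∀ {s t d d′} → IsLeftCorner ρ s t d → 0 < d → ¬ IsRightCorner ρ s t d′
  leftNotRight {s} {d = d} lc@(_ , d≤Ps , _) 0<d (_ , range , _) with leftTrough lc
  ... | (m , s≤m , m≤t , Pm≡) =
    <⇒≱ (∸-monoʳ-< {P s} {d} {0} 0<d d≤Ps) (subst (P s ≤_) Pm≡ (proj₁ (range m s≤m m≤t)))

  rightExtent : ∀ {s t d m D} → IsRightCorner ρ s t d → s ≤ m → m ≤ t → P s + D < P m → D < d
  rightExtent {s} {d = d} {m} {D} (_ , range , _) s≤m m≤t far =
    +-cancelˡ-< (P s) D d (<-≤-trans far (proj₂ (range m s≤m m≤t)))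

  leftExtent : ∀ {s t d m D} → IsLeftCorner ρ s t d → s ≤ m → m ≤ t → P m + D < P s → D < d
  leftExtent {s} {d = d} {m} {D} (_ , d≤Ps , range , _) s≤m m≤t far =
    +-cancelˡ-< (P m) D d (<-≤-trans far Ps≤Pm+d)
    where
    Ps≤Pm+d : P s ≤ P m + d
    Ps≤Pm+d = ≤-trans (≤-reflexive (sym (m∸n+n≡m d≤Ps)))
                      (+-monoˡ-≤ d (proj₁ (range m s≤m m≤t)))

  long⇒far : ∀ {s t} → IsLong ρ s t → ∃[ m ] (s ≤ m × m ≤ t × Far (N * N) (P s) (P m))
  long⇒far {s} (d , D<d , inj₁ rc) with rightPeak rc
  ... | (m , s≤m , m≤t , Pm≡) =
    m , s≤m , m≤t , inj₁ (subst (P s + N * N <_) (sym Pm≡) (+-monoʳ-< (P s) D<d))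
  long⇒far {s} (d , D<d , inj₂ lc@(_ , d≤Ps , _)) with leftTrough lc
  ... | (m , s≤m , m≤t , Pm≡) =
    m , s≤m , m≤t , inj₂ (subst (λ z → z + N * N < P s) (sym Pm≡) (troughFar d≤Ps D<d))

  -- A basic corner never visits both sides of its base: otherwise the path
  -- would cross the base level strictly inside the corner.
  basicOneSided : ∀ {s t y m} → IsBasic ρ s t → t ≤ L → s ≤ y → y ≤ t → s ≤ m → m ≤ t →
    P y < P s → P s < P m → ⊥
  basicOneSided {s} {t} {y} {m} (_ , basic) t≤L s≤y y≤t s≤m m≤t Py<Ps Ps<Pm with y ≤? m
  ... | yes y≤m with Crossing.innerHit (above steps (P s)) y≤m (≤-trans m≤t t≤L)
                       (<-asym Py<Ps) (<⇒≢ Py<Ps) Ps<Pm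
  ...   | (x , y<x , x<m , Px≡Ps) = basic x (≤-<-trans s≤y y<x) (<-≤-trans x<m m≤t) Px≡Ps
  basicOneSided {s} {t} {y} {m} (_ , basic) t≤L s≤y y≤t s≤m m≤t Py<Ps Ps<Pm | no y≰m
    with Crossing.innerHit (below steps (P s)) (<⇒≤ (≰⇒> y≰m)) (≤-trans y≤t t≤L)
           (<-asym Ps<Pm) (>⇒≢ Ps<Pm) Py<Ps
  ... | (x , m<x , x<y , Px≡Ps) = basic x (≤-<-trans s≤m m<x) (<-≤-trans x<y y≤t) Px≡Ps

  -- A corner staying weakly above (below) its base is a right (left) corner,
  -- whose extent is the distance from the base to the highest (lowest) point.
  rightCorner : ∀ {s t} → IsCorner ρ s t → t ≤ L → (∀ y → s ≤ y → y ≤ t → P s ≤ P y) →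
    ∃[ d ] IsRightCorner ρ s t d
  rightCorner {s} {t} corner@(s<t , _) t≤L atLeastBase
    with extremum ≤-total ≤-trans P t (<⇒≤ s<t)
  ... | (x , s≤x , x≤t , highest) = P x ∸ P s , corner , range , onto
    where
    Ps+d≡Px : P s + (P x ∸ P s) ≡ P x
    Ps+d≡Px = m+[n∸m]≡n (atLeastBase x s≤x x≤t)
    range : ∀ i → s ≤ i → i ≤ t → InRange (P s) (P s + (P x ∸ P s)) (P i)
    range i s≤i i≤t = atLeastBase i s≤i i≤t , subst (P i ≤_) (sym Ps+d≡Px) (highest i s≤i i≤t)
    onto : ∀ k → InRange (P s) (P s + (P x ∸ P s)) k → ∃[ i ] (s ≤ i × i ≤ t × P i ≡ k)
    onto k (Ps≤k , k≤) with reach steps s≤x (≤-trans x≤t t≤L) (inj₁ (Ps≤k , subst (k ≤_) Ps+d≡Px k≤))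
    ... | (i , s≤i , i≤x , Pi≡k) = i , s≤i , ≤-trans i≤x x≤t , Pi≡k

  leftCorner : ∀ {s t} → IsCorner ρ s t → t ≤ L → (∀ y → s ≤ y → y ≤ t → P y ≤ P s) →
    ∃[ d ] IsLeftCorner ρ s t d
  leftCorner {s} {t} corner@(s<t , _) t≤L atMostBase
    with extremum {_≥_} (λ u v → ≤-total v u) (λ j≤i k≤j → ≤-trans k≤j j≤i) P t (<⇒≤ s<t)
  ... | (x , s≤x , x≤t , lowest) = P s ∸ P x , corner , m∸n≤m (P s) (P x) , range , onto
    where
    Ps∸d≡Px : P s ∸ (P s ∸ P x) ≡ P x
    Ps∸d≡Px = m∸[m∸n]≡n (atMostBase x s≤x x≤t)
    range : ∀ i → s ≤ i → i ≤ t → InRange (P s ∸ (P s ∸ P x)) (P s) (P i)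
    range i s≤i i≤t = subst (_≤ P i) (sym Ps∸d≡Px) (lowest i s≤i i≤t) , atMostBase i s≤i i≤t
    onto : ∀ k → InRange (P s ∸ (P s ∸ P x)) (P s) k → ∃[ i ] (s ≤ i × i ≤ t × P i ≡ k)
    onto k (≤k , k≤Ps) with reach steps s≤x (≤-trans x≤t t≤L) (inj₂ (subst (_≤ k) Ps∸d≡Px ≤k , k≤Ps))
    ... | (i , s≤i , i≤x , Pi≡k) = i , s≤i , ≤-trans i≤x x≤t , Pi≡k

  staysAbove : ∀ {s t m} → IsBasic ρ s t → t ≤ L → s ≤ m → m ≤ t → P s < P m →
    ∀ y → s ≤ y → y ≤ t → P s ≤ P y
  staysAbove basic t≤L s≤m m≤t Ps<Pm y s≤y y≤t =
    ≮⇒≥ λ Py<Ps → basicOneSided basic t≤L s≤y y≤t s≤m m≤t Py<Ps Ps<Pm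

  staysBelow : ∀ {s t m} → IsBasic ρ s t → t ≤ L → s ≤ m → m ≤ t → P m < P s →
    ∀ y → s ≤ y → y ≤ t → P y ≤ P s
  staysBelow basic t≤L s≤m m≤t Pm<Ps y s≤y y≤t =
    ≮⇒≥ λ Ps<Py → basicOneSided basic t≤L s≤m m≤t s≤y y≤t Pm<Ps Ps<Py

  far⇒long : ∀ {s t m} → IsBasic ρ s t → t ≤ L → s ≤ m → m ≤ t → Far (N * N) (P s) (P m) →
    IsLong ρ s t
  far⇒long {s} basic@(corner , _) t≤L s≤m m≤t (inj₁ far)
    with rightCorner corner t≤L
           (staysAbove basic t≤L s≤m m≤t (≤-<-trans (m≤m+n (P s) (N * N)) far))
  ... | (d , rc) = d , rightExtent rc s≤m m≤t far , inj₁ rc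
  far⇒long {m = m} basic@(corner , _) t≤L s≤m m≤t (inj₂ far)
    with leftCorner corner t≤L
           (staysBelow basic t≤L s≤m m≤t (≤-<-trans (m≤m+n (P m) (N * N)) far))
  ... | (d , lc) = d , leftExtent lc s≤m m≤t far , inj₂ lc

  -- Two basic corners ending at the same vertex start at the same vertex:
  -- the later start would be an interior return to the earlier base.
  uniqueStart : ∀ {s s′ t} → IsBasic ρ s t → IsBasic ρ s′ t → s ≡ s′
  uniqueStart {s} {s′} ((s<t , Ps≡Pt) , basic) ((s′<t , Ps′≡Pt) , basic′) with <-cmp s s′
  ... | tri≈ _ s≡s′ _ = s≡s′
  ... | tri< s<s′ _ _ = ⊥-elim (basic s′ s<s′ s′<t (trans Ps′≡Pt (sym Ps≡Pt)))
  ... | tri> _ _ s′<s = ⊥-elim (basic′ s s′<s s<t (trans Ps≡Pt (sym Ps′≡Pt)))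

  -- A bounded, hence decidable, description of "s..t is an lb-corner
  -- starting at or after a": long is replaced by far, using far⇒long.
  LBShape : ℕ → ℕ → ℕ → Set
  LBShape a t s =
    a ≤ s × P s ≡ P t × (∀ {i} → i < t → s < i → P i ≢ P s) ×
    ∃[ m ] (m < suc t × s ≤ m × Far (N * N) (P s) (P m))

  lbShape? : ∀ a t s → Dec (LBShape a t s)
  lbShape? a t s =
    (a ≤? s) ×-dec (P s ≟ P t) ×-dec
    allUpTo? (λ i → (s <? i) →-dec ¬? (P i ≟ P s)) t ×-dec
    anyUpTo? (λ m → (s ≤? m) ×-dec far? (N * N) (P s) (P m)) (suc t)

  endsLB? : ∀ {a b} → b ≤ L → ∀ t → Dec (∃[ s ] IsLBIn ρ a b s t)
  endsLB? {a} {b} b≤L t = map′ toLB fromLB ((t ≤? b) ×-dec anyUpTo? (lbShape? a t) t)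
    where
    toLB : t ≤ b × ∃[ s ] (s < t × LBShape a t s) → ∃[ s ] IsLBIn ρ a b s t
    toLB (t≤b , s , s<t , a≤s , Ps≡Pt , noReturn , m , m<st , s≤m , far) =
      s , a≤s , t≤b , far⇒long isBasic (≤-trans t≤b b≤L) s≤m (s≤s⁻¹ m<st) far , isBasic
      where
      isBasic : IsBasic ρ s t
      isBasic = (s<t , Ps≡Pt) , λ i s<i i<t → noReturn i<t s<i
    fromLB : ∃[ s ] IsLBIn ρ a b s t → t ≤ b × ∃[ s ] (s < t × LBShape a t s)
    fromLB (s , a≤s , t≤b , long , (s<t , Ps≡Pt) , basic) with long⇒far long
    ... | (m , s≤m , m≤t , far) =
      t≤b , s , s<t , a≤s , Ps≡Pt , (λ i<t s<i → basic _ s<i i<t) , m , s≤s m≤t , s≤m , far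

  -- If a..b has an lb-corner, it has a first one: the one ending earliest.
  firstLBExists : ∀ {a b} → b ≤ L → ∃[ s ] ∃[ t ] IsLBIn ρ a b s t →
    ∃[ s ] ∃[ t ] IsFirstLB ρ a b s t
  firstLBExists {a} {b} b≤L (s₀ , t₀ , lb₀) with leastWitness (endsLB? b≤L) (s₀ , lb₀)
  ... | (t , _ , (s , lb) , earlier) = s , t , lb , onlyOne
    where
    onlyOne : ∀ s′ t′ → IsLBIn ρ a b s′ t′ → t′ ≤ t → s′ ≡ s × t′ ≡ t
    onlyOne s′ t′ lb′ t′≤t with m≤n⇒m<n∨m≡n t′≤t
    ... | inj₁ t′<t = ⊥-elim (earlier t′ t′<t (s′ , lb′))
    ... | inj₂ refl = uniqueStart (proj₂ (proj₂ (proj₂ lb′))) (proj₂ (proj₂ (proj₂ lb))) , refl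

  -- Starting outside a side of the level k at a, passing through the side at
  -- s and returning to k at m, the path makes a basic corner at level k
  -- around s: from its last entry into the side before s to its first exit
  -- after s.
  excursionAround : ∀ {a s m k} (S : Side P L k) → a ≤ s → s ≤ m → m ≤ L →
    ¬ Side.In S a → Side.In S s → P m ≡ k →
    ∃[ i ] ∃[ j ] (a ≤ i × i < s × s < j × j ≤ m × P i ≡ k × IsBasic ρ i j)
  excursionAround {s = s} {m} S a≤s s≤m m≤L outA inS Pm≡k
    with Crossing.lastEntryPoint S a≤s (≤-trans s≤m m≤L) outA inS
       | Crossing.firstExitPoint S s≤m m≤L inS (λ inM → Side.avoids S inM Pm≡k)
  ... | (i , a≤i , i<s , Pi≡k , inAfter) | (j , s<j , j≤m , Pj≡k , inBefore) =
    i , j , a≤i , i<s , s<j , j≤m , Pi≡k , (<-trans i<s s<j , trans Pi≡k (sym Pj≡k)) , noReturn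
    where
    inSide : ∀ y → i < y → y < j → Side.In S y
    inSide y i<y y<j with y ≤? s
    ... | yes y≤s = inAfter y i<y y≤s
    ... | no y≰s = inBefore y (<⇒≤ (≰⇒> y≰s)) y<j
    noReturn : ∀ y → i < y → y < j → P y ≢ P i
    noReturn y i<y y<j Py≡Pi = Side.avoids S (inSide y i<y y<j) (trans Py≡Pi Pi≡k)

  -- If (s..t) is the first lb-corner of a..b, a lies outside a
  -- side of the level k and s lies in it, far from k, then the path does not
  -- return to k before t: the excursion around s would be an earlier
  -- lb-corner of a..b.
  firstLBNoReturn : ∀ {a b s t k m} (S : Side P L k) → b ≤ L → IsFirstLB ρ a b s t →
    ¬ Side.In S a → Side.In S s → Far (N * N) k (P s) → s ≤ m → m ≤ t → P m ≡ k → ⊥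
  firstLBNoReturn {a} {b} {s} {t} {m = m} S b≤L ((a≤s , t≤b , _ , (_ , Ps≡Pt) , _) , first)
    outA inS far s≤m m≤t Pm≡k
    with excursionAround S a≤s s≤m (≤-trans m≤t t≤L) outA inS Pm≡k
    where
    t≤L : t ≤ L
    t≤L = ≤-trans t≤b b≤L
  ... | (i , j , a≤i , i<s , s<j , j≤m , Pi≡k , excursion) =
    <⇒≢ (≤-<-trans j≤m m<t) (proj₂ (first i j earlierLB (≤-trans j≤m m≤t)))
    where
    m<t : m < t
    m<t = ≤∧≢⇒< m≤t λ m≡t → Side.avoids S inS (trans Ps≡Pt (trans (cong P (sym m≡t)) Pm≡k))
    earlierLB : IsLBIn ρ a b i j
    earlierLB = a≤i , ≤-trans j≤m (≤-trans m≤t t≤b) ,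
      far⇒long excursion (≤-trans j≤m (≤-trans m≤t (≤-trans t≤b b≤L))) (<⇒≤ i<s) (<⇒≤ s<j)
        (subst (λ z → Far (N * N) z (P s)) (sym Pi≡k) far) ,
      excursion

  -- If no vertex of a..b is below its start, the first lb-corner of a..b is
  -- not a left corner: its lowest point would be a return to a level that
  -- the path left upwards at the start s of the corner.
  firstLBNotLeft : ∀ {a b s t d} → b ≤ L → (∀ y → a ≤ y → y ≤ b → P a ≤ P y) →
    IsFirstLB ρ a b s t → N * N < d → ¬ IsLeftCorner ρ s t d
  firstLBNotLeft {a} {s = s} {d = d} b≤L lowestAtStart first@((a≤s , t≤b , _) , _) D<d
    lc@(_ , d≤Ps , _) with leftTrough lc
  ... | (m , s≤m , m≤t , Pm≡) =
    firstLBNoReturn (above steps (P s ∸ d)) b≤L first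
      (≤⇒≯ (subst (P a ≤_) Pm≡ (lowestAtStart m (≤-trans a≤s s≤m) (≤-trans m≤t t≤b))))
      (∸-monoʳ-< {P s} {d} {0} (≤-<-trans z≤n D<d) d≤Ps)
      (inj₁ (troughFar d≤Ps D<d)) s≤m m≤t Pm≡

  firstLBNotRight : ∀ {a b s t d} → b ≤ L → (∀ y → a ≤ y → y ≤ b → P y ≤ P a) →
    IsFirstLB ρ a b s t → N * N < d → ¬ IsRightCorner ρ s t d
  firstLBNotRight {a} {s = s} {d = d} b≤L highestAtStart first@((a≤s , t≤b , _) , _) D<d rc
    with rightPeak rc
  ... | (m , s≤m , m≤t , Pm≡) =
    firstLBNoReturn (below steps (P s + d)) b≤L first
      (≤⇒≯ (subst (_≤ P a) Pm≡ (highestAtStart m (≤-trans a≤s s≤m) (≤-trans m≤t t≤b))))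
      (m<m+n (P s) (≤-<-trans z≤n D<d))
      (inj₂ (+-monoʳ-< (P s) D<d)) s≤m m≤t Pm≡

  firstLBIsRight : ∀ {a b s t} → b ≤ L → (∀ y → a ≤ y → y ≤ b → P a ≤ P y) →
    IsFirstLB ρ a b s t → (∃[ d ] IsRightCorner ρ s t d) × ¬ (∃[ d ] IsLeftCorner ρ s t d)
  firstLBIsRight _ _ ((_ , _ , (d , D<d , inj₁ rc) , _) , _) =
    (d , rc) , λ (_ , lc) → rightNotLeft rc (≤-<-trans z≤n D<d) lc
  firstLBIsRight b≤L lowestAtStart first@((_ , _ , (d , D<d , inj₂ lc) , _) , _) =
    ⊥-elim (firstLBNotLeft b≤L lowestAtStart first D<d lc)

  firstLBIsLeft : ∀ {a b s t} → b ≤ L → (∀ y → a ≤ y → y ≤ b → P y ≤ P a) →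
    IsFirstLB ρ a b s t → (∃[ d ] IsLeftCorner ρ s t d) × ¬ (∃[ d ] IsRightCorner ρ s t d)
  firstLBIsLeft _ _ ((_ , _ , (d , D<d , inj₂ lc) , _) , _) =
    (d , lc) , λ (_ , rc) → leftNotRight lc (≤-<-trans z≤n D<d) rc
  firstLBIsLeft b≤L highestAtStart first@((_ , _ , (d , D<d , inj₁ rc) , _) , _) =
    ⊥-elim (firstLBNotRight b≤L highestAtStart first D<d rc)

  -- A segment of a path between extremal vertices starts at p or at q: either
  -- it starts the path, at position 0 or n, or the vertex before it lies
  -- outside {p,…,q} and is one step away.
  segmentStart : ∀ {p q a b} → q ≤ n → BetweenExtremal ρ → IsSegment ρ p q a b →
    P a ≡ p ⊎ P a ≡ q
  segmentStart {p} {q} {zero} q≤n (inj₁ P0≡0 , _) (0<b , _ , inRange , _) =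
    inj₁ (≤-antisym (subst (_≤ p) (sym P0≡0) z≤n) (proj₁ (inRange 0 ≤-refl (<⇒≤ 0<b))))
  segmentStart {p} {q} {zero} q≤n (inj₂ P0≡n , _) (0<b , _ , inRange , _) =
    inj₂ (≤-antisym (proj₂ (inRange 0 ≤-refl (<⇒≤ 0<b))) (subst (q ≤_) (sym P0≡n) q≤n))
  segmentStart {p} {q} {suc a} {b} q≤n _ (a<b , b≤L , inRange , maximal , _)
    with inRange (suc a) ≤-refl (<⇒≤ a<b) | p ≤? P a | P a ≤? q
  ... | _ | yes p≤Pa | yes Pa≤q = ⊥-elim (maximal a refl (p≤Pa , Pa≤q))
  ... | (p≤Psa , _) | no p≰Pa | _ =
    inj₁ (≤-antisym (≤-trans (proj₁ (steps a a<L)) (≰⇒> p≰Pa)) p≤Psa)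
    where
    a<L : a < L
    a<L = <-trans (n<1+n a) (<-≤-trans a<b b≤L)
  ... | (_ , Psa≤q) | yes _ | no Pa≰q =
    inj₂ (≤-antisym Psa≤q (s≤s⁻¹ (≤-trans (≰⇒> Pa≰q) (proj₂ (steps a a<L)))))
    where
    a<L : a < L
    a<L = <-trans (n<1+n a) (<-≤-trans a<b b≤L)

proposition9 : (N : ℕ) (R : DBC N) (n : ℕ) → 1 ≤ n →
    (p q : ℕ) → p ≤ q → q ≤ n →
    (ρ : Path R n) → BetweenExtremal ρ →
    (a b : ℕ) → IsSegment ρ p q a b →
    ∃[ s ] ∃[ t ] IsLBIn ρ a b s t →
    (∃[ s ] ∃[ t ] IsFirstLB ρ a b s t) ×
    (∀ s t → IsFirstLB ρ a b s t →
      ((∃[ d ] IsRightCorner ρ s t d) ⇔ (posAt ρ a ≡ p)) ×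
      ((∃[ d ] IsLeftCorner ρ s t d) ⇔ (posAt ρ a ≡ q)))
proposition9 N R n _ p q _ q≤n ρ extremal a b seg@(_ , b≤L , inRange , _) someLB =
  firstLBExists b≤L someLB , classify
  where
  open Corners ρ
  lowestAtStart : P a ≡ p → ∀ y → a ≤ y → y ≤ b → P a ≤ P y
  lowestAtStart Pa≡p y a≤y y≤b = subst (_≤ P y) (sym Pa≡p) (proj₁ (inRange y a≤y y≤b))
  highestAtStart : P a ≡ q → ∀ y → a ≤ y → y ≤ b → P y ≤ P a
  highestAtStart Pa≡q y a≤y y≤b = subst (P y ≤_) (sym Pa≡q) (proj₂ (inRange y a≤y y≤b))
  classify : ∀ s t → IsFirstLB ρ a b s t →
    ((∃[ d ] IsRightCorner ρ s t d) ⇔ (P a ≡ p)) × ((∃[ d ] IsLeftCorner ρ s t d) ⇔ (P a ≡ q))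
  classify s t first with segmentStart q≤n extremal seg
  ... | inj₁ Pa≡p =
    mk⇔ (λ _ → Pa≡p) (λ _ → proj₁ right) ,
    mk⇔ (⊥-elim ∘ proj₂ right) (λ Pa≡q → proj₁ (firstLBIsLeft b≤L (highestAtStart Pa≡q) first))
    where right = firstLBIsRight b≤L (lowestAtStart Pa≡p) first
  ... | inj₂ Pa≡q =
    mk⇔ (⊥-elim ∘ proj₂ left) (λ Pa≡p → proj₁ (firstLBIsRight b≤L (lowestAtStart Pa≡p) first)) ,
    mk⇔ (λ _ → Pa≡q) (λ _ → proj₁ left)
    where left = firstLBIsLeft b≤L (highestAtStart Pa≡q) first
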